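{- For a sequence $\vec{x}=\langle x_n:n<\omega\rangle$ in an abelian group $G$, the following are equivalent: (i) $\vec{x}$ satisfies the 2-uniqueness of finite sums; (ii) whenever $a,b,c,d\in[\omega]^{<\omega}$ satisfy $a\cap b=\varnothing=c\cap d$ and $2\sum_{n\in a}x_n+\sum_{n\in b}x_n=2\sum_{n\in c}x_n+\sum_{n\in d}x_n$, then $a=c$ and $b=d$; (iii) whenever $a,b,c,d\in[\omega]^{<\omega}$ satisfy $\sum_{n\in a}x_n+\sum_{n\in b}x_n=\sum_{n\in c}x_n+\sum_{n\in d}x_n$, then $a\triangle b=c\triangle d$ and $a\cap b=c\cap d$.
   Context: $[\omega]^{<\omega}$ is the set of finite subsets of $\omega$; the empty sum equals $0$. A sequence $\vec{x}$ satisfies the 2-uniqueness of finite sums if whenever $a,b\in[\omega]^{<\omega}$ and $\varepsilon:a\to\{1,2\}$, $\delta:b\to\{1,2\}$ satisfy $\sum_{n\in a}\varepsilon(n)x_n=\sum_{n\in b}\delta(n)x_n$, then $a=b$ and $\varepsilon=\delta$. -}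

module Defs where

open import Level using (Level; _⊔_)
open import Data.Nat using (ℕ; zero; suc; _≤_)
open import Data.Bool using (Bool; true; false; if_then_else_; _xor_; _∧_)
open import Data.Product using (_×_)
open import Relation.Binary.PropositionalEquality using (_≡_)
open import Algebra.Bundles using (AbelianGroup)

record FinSet : Set where
  field
    bound   : ℕ
    mem     : ℕ → Bool
    bounded : ∀ n → bound ≤ n → mem n ≡ false
open FinSet public

_≐_ : FinSet → FinSet → Set
a ≐ b = ∀ n → mem a n ≡ mem b n

Disjoint : FinSet → FinSet → Set
Disjoint a b = ∀ n → mem a n ∧ mem b n ≡ false

data Coef : Set where
  one two : Coef

module _ {c ℓ : Level} (G : AbelianGroup c ℓ) where
  open AbelianGroup G

  sumBelow : ℕ → (ℕ → Carrier) → Carrier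
  sumBelow zero    f = ε
  sumBelow (suc N) f = sumBelow N f ∙ f N

  -- Σ_{n ∈ a} f n  (independent of the chosen bound since f is only used on a)
  sumOver : FinSet → (ℕ → Carrier) → Carrier
  sumOver a f = sumBelow (bound a) (λ n → if mem a n then f n else ε)

  twice : Carrier → Carrier
  twice g = g ∙ g

  scale : Coef → Carrier → Carrier
  scale one g = g
  scale two g = twice g

  TwoUnique : (ℕ → Carrier) → Set ℓ
  TwoUnique x =
    ∀ (a b : FinSet) (e d : ℕ → Coef) →
      sumOver a (λ n → scale (e n) (x n)) ≈ sumOver b (λ n → scale (d n) (x n)) →
      (a ≐ b) × (∀ n → mem a n ≡ true → e n ≡ d n)

  CondII : (ℕ → Carrier) → Set ℓ
  CondII x =
    ∀ (a b c' d : FinSet) → Disjoint a b → Disjoint c' d →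
      twice (sumOver a x) ∙ sumOver b x ≈ twice (sumOver c' x) ∙ sumOver d x →
      (a ≐ c') × (b ≐ d)

  CondIII : (ℕ → Carrier) → Set ℓ
  CondIII x =
    ∀ (a b c' d : FinSet) →
      sumOver a x ∙ sumOver b x ≈ sumOver c' x ∙ sumOver d x →
      (∀ n → mem a n xor mem b n ≡ mem c' n xor mem d n) ×
      (∀ n → mem a n ∧ mem b n ≡ mem c' n ∧ mem d n)

-- Weighted sums with coefficients in {0,1,2} can be encoded in three ways: as a set with
-- a {1,2}-labelling, as 2x_a + x_b with a and b disjoint, and as x_a + x_b for arbitrary a and b.
-- Splitting a labelled set into its fibres over 2 and over 1 turns the first encoding into the
-- second, and back again via the union with labels 2 on a and 1 on b; this gives (i) ⇔ (ii).
-- The identity x_a + x_b = 2x_{a∩b} + x_{a△b} turns the third into the second, and for disjoint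
-- a, b the instance 2x_a + x_b = x_a + x_{a∪b} turns the second into the third; this gives
-- (ii) ⇔ (iii).
module Submission where

open import Defs
open import Level using (Level)
open import Function using (_∘_)
open import Data.Nat using (ℕ; zero; suc; _≤_; _⊔_; _≤′_; ≤′-refl; ≤′-step)
open import Data.Nat.Properties using (m≤m⊔n; m≤n⊔m; m⊔n≤o⇒m≤o; m⊔n≤o⇒n≤o; ≤⇒≤′; ≤′⇒≤)
open import Data.Bool using (Bool; true; false; if_then_else_; _xor_; _∧_; _∨_)
open import Data.Bool.Properties using (∧-abs-∨)
open import Data.Product using (_×_; _,_; proj₁; proj₂)
open import Relation.Binary.PropositionalEquality as ≡ using (_≡_; refl; cong)
open import Algebra.Bundles using (AbelianGroup)
import Algebra.Properties.CommutativeSemigroup as CommutativeSemigroupProperties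
import Relation.Binary.Reasoning.Setoid as SetoidReasoning

_==_ : Coef → Coef → Bool
one == one = true
two == two = true
_   == _   = false

twoIf : Bool → Coef
twoIf true  = two
twoIf false = one

guarded-∧-cong : ∀ {α β p q : Bool} → α ≡ β → (α ≡ true → p ≡ q) → α ∧ p ≡ β ∧ q
guarded-∧-cong {true}  refl p≡q = p≡q refl
guarded-∧-cong {false} refl _   = refl

∧-xor-disjoint : ∀ α β → (α ∧ β) ∧ (α xor β) ≡ false
∧-xor-disjoint true  true  = refl
∧-xor-disjoint true  false = refl
∧-xor-disjoint false β     = refl

xor-∨-disjoint : ∀ {α β} → α ∧ β ≡ false → α xor (α ∨ β) ≡ β
xor-∨-disjoint {true}  α∧β≡false = ≡.sym α∧β≡false
xor-∨-disjoint {false} _         = refl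

fibres-disjoint : ∀ α k → (α ∧ (k == two)) ∧ (α ∧ (k == one)) ≡ false
fibres-disjoint true  one = refl
fibres-disjoint true  two = refl
fibres-disjoint false k   = refl

fibres-injective : ∀ α β k l →
                   α ∧ (k == two) ≡ β ∧ (l == two) → α ∧ (k == one) ≡ β ∧ (l == one) →
                   (α ≡ β) × (α ≡ true → k ≡ l)
fibres-injective true  true  one one _  _  = refl , λ _ → refl
fibres-injective true  true  two two _  _  = refl , λ _ → refl
fibres-injective true  true  one two () _
fibres-injective true  true  two one () _
fibres-injective true  false one l  _  ()
fibres-injective true  false two l  () _
fibres-injective false true  k   one _  ()
fibres-injective false true  k   two () _
fibres-injective false false k   l  _  _  = refl , λ ()

twoIf-fibre-two : ∀ α β → (α ∨ β) ∧ (twoIf α == two) ≡ α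
twoIf-fibre-two true  β     = refl
twoIf-fibre-two false true  = refl
twoIf-fibre-two false false = refl

twoIf-fibre-one : ∀ {α β} → α ∧ β ≡ false → (α ∨ β) ∧ (twoIf α == one) ≡ β
twoIf-fibre-one {true}          α∧β≡false = ≡.sym α∧β≡false
twoIf-fibre-one {false} {true}  _         = refl
twoIf-fibre-one {false} {false} _         = refl

zipSet : (_⊕_ : Bool → Bool → Bool) → false ⊕ false ≡ false → FinSet → FinSet → FinSet
zipSet _⊕_ ff≡f a b = record
  { bound   = bound a ⊔ bound b
  ; mem     = λ n → mem a n ⊕ mem b n
  ; bounded = λ n ≤n → vanish (bounded a n (m⊔n≤o⇒m≤o _ _ ≤n)) (bounded b n (m⊔n≤o⇒n≤o _ _ ≤n))
  }
  where
  vanish : ∀ {α β} → α ≡ false → β ≡ false → α ⊕ β ≡ false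
  vanish refl refl = ff≡f

infixl 22 _∪_ _△_
infixl 23 _∩_

_∩_ _∪_ _△_ : FinSet → FinSet → FinSet
_∩_ = zipSet _∧_ refl
_∪_ = zipSet _∨_ refl
_△_ = zipSet _xor_ refl

fibre : FinSet → (ℕ → Coef) → Coef → FinSet
fibre a e k = record
  { bound   = bound a
  ; mem     = λ n → mem a n ∧ (e n == k)
  ; bounded = λ n ≤n → cong (_∧ (e n == k)) (bounded a n ≤n)
  }

fibre-cong : ∀ a b {e d} k → a ≐ b → (∀ n → mem a n ≡ true → e n ≡ d n) →
             fibre a e k ≐ fibre b d k
fibre-cong a b k a≐b e≡d n = guarded-∧-cong (a≐b n) (λ n∈a → cong (_== k) (e≡d n n∈a))

∩-absorbs-∪ : ∀ a b → a ∩ (a ∪ b) ≐ a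
∩-absorbs-∪ a b n = ∧-abs-∨ (mem a n) (mem b n)

△-∪-disjoint : ∀ a b → Disjoint a b → a △ (a ∪ b) ≐ b
△-∪-disjoint a b a#b n = xor-∨-disjoint (a#b n)

fibre-two-∪ : ∀ a b → fibre (a ∪ b) (twoIf ∘ mem a) two ≐ a
fibre-two-∪ a b n = twoIf-fibre-two (mem a n) (mem b n)

fibre-one-∪ : ∀ a b → Disjoint a b → fibre (a ∪ b) (twoIf ∘ mem a) one ≐ b
fibre-one-∪ a b a#b n = twoIf-fibre-one (a#b n)

module Sums {c ℓ : Level} (G : AbelianGroup c ℓ) where
  open AbelianGroup G renaming (refl to ≈-refl; sym to ≈-sym; trans to ≈-trans; reflexive to ≈-reflexive)
  open CommutativeSemigroupProperties commutativeSemigroup using (interchange)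
  open SetoidReasoning setoid

  twice-ε-∙ : ∀ g → twice G ε ∙ g ≈ g
  twice-ε-∙ g = ≈-trans (∙-cong (identityˡ ε) ≈-refl) (identityˡ g)

  sumBelow-cong : ∀ N {f g : ℕ → Carrier} → (∀ n → f n ≈ g n) → sumBelow G N f ≈ sumBelow G N g
  sumBelow-cong zero    f≈g = ≈-refl
  sumBelow-cong (suc N) f≈g = ∙-cong (sumBelow-cong N f≈g) (f≈g N)

  sumBelow-∙ : ∀ N (f g : ℕ → Carrier) →
               sumBelow G N f ∙ sumBelow G N g ≈ sumBelow G N (λ n → f n ∙ g n)
  sumBelow-∙ zero    f g = identityˡ ε
  sumBelow-∙ (suc N) f g = begin
    (sumBelow G N f ∙ f N) ∙ (sumBelow G N g ∙ g N) ≈⟨ interchange _ _ _ _ ⟩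
    (sumBelow G N f ∙ sumBelow G N g) ∙ (f N ∙ g N) ≈⟨ ∙-cong (sumBelow-∙ N f g) ≈-refl ⟩
    sumBelow G N (λ n → f n ∙ g n) ∙ (f N ∙ g N)    ∎

  sumBelow-twice-∙ : ∀ N (f g : ℕ → Carrier) →
                     twice G (sumBelow G N f) ∙ sumBelow G N g ≈
                     sumBelow G N (λ n → twice G (f n) ∙ g n)
  sumBelow-twice-∙ N f g = ≈-trans (∙-cong (sumBelow-∙ N f f) ≈-refl) (sumBelow-∙ N _ g)

  sumBelow-extend : ∀ {N M} (f : ℕ → Carrier) → N ≤′ M → (∀ n → N ≤ n → f n ≈ ε) →
                    sumBelow G M f ≈ sumBelow G N f
  sumBelow-extend f ≤′-refl           _ = ≈-refl
  sumBelow-extend f (≤′-step N≤′M) f≈ε =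
    ≈-trans (∙-cong (sumBelow-extend f N≤′M f≈ε) (f≈ε _ (≤′⇒≤ N≤′M))) (identityʳ _)

  sumOver-extend : ∀ (a : FinSet) {B} (f : ℕ → Carrier) → bound a ≤ B →
                   sumOver G a f ≈ sumBelow G B (λ n → if mem a n then f n else ε)
  sumOver-extend a f ≤B = ≈-sym (sumBelow-extend _ (≤⇒≤′ ≤B) vanish)
    where
    vanish : ∀ n → bound a ≤ n → (if mem a n then f n else ε) ≈ ε
    vanish n ≤n = ≈-reflexive (cong (if_then f n else ε) (bounded a n ≤n))

  sumOver-cong : ∀ (a b : FinSet) (f : ℕ → Carrier) → a ≐ b → sumOver G a f ≈ sumOver G b f
  sumOver-cong a b f a≐b = begin
    sumOver G a f                                     ≈⟨ sumOver-extend a f (m≤m⊔n (bound a) (bound b)) ⟩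
    sumBelow G B (λ n → if mem a n then f n else ε)   ≈⟨ sumBelow-cong B same-terms ⟩
    sumBelow G B (λ n → if mem b n then f n else ε)   ≈⟨ sumOver-extend b f (m≤n⊔m (bound a) (bound b)) ⟨
    sumOver G b f                                     ∎
    where
    B = bound a ⊔ bound b
    same-terms : ∀ n → (if mem a n then f n else ε) ≈ (if mem b n then f n else ε)
    same-terms n = ≈-reflexive (cong (if_then f n else ε) (a≐b n))

  ∙-as-∩-△ : ∀ α β g → (if α then g else ε) ∙ (if β then g else ε) ≈
                        twice G (if α ∧ β then g else ε) ∙ (if α xor β then g else ε)
  ∙-as-∩-△ true  true  g = ≈-sym (identityʳ _)
  ∙-as-∩-△ true  false g = ≈-trans (identityʳ g) (≈-sym (twice-ε-∙ g))
  ∙-as-∩-△ false true  g = ≈-trans (identityˡ g) (≈-sym (twice-ε-∙ g))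
  ∙-as-∩-△ false false g = ≈-sym (identityʳ _)

  sumOver-∙ : ∀ a b (f : ℕ → Carrier) →
              sumOver G a f ∙ sumOver G b f ≈ twice G (sumOver G (a ∩ b) f) ∙ sumOver G (a △ b) f
  sumOver-∙ a b f = begin
    sumOver G a f ∙ sumOver G b f
      ≈⟨ ∙-cong (sumOver-extend a f (m≤m⊔n (bound a) (bound b)))
                (sumOver-extend b f (m≤n⊔m (bound a) (bound b))) ⟩
    sumBelow G B (λ n → if mem a n then f n else ε) ∙ sumBelow G B (λ n → if mem b n then f n else ε)
      ≈⟨ sumBelow-∙ B _ _ ⟩
    sumBelow G B (λ n → (if mem a n then f n else ε) ∙ (if mem b n then f n else ε))
      ≈⟨ sumBelow-cong B (λ n → ∙-as-∩-△ (mem a n) (mem b n) (f n)) ⟩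
    sumBelow G B (λ n → twice G (if mem a n ∧ mem b n then f n else ε) ∙
                        (if mem a n xor mem b n then f n else ε))
      ≈⟨ sumBelow-twice-∙ B _ _ ⟨
    twice G (sumOver G (a ∩ b) f) ∙ sumOver G (a △ b) f ∎
    where B = bound a ⊔ bound b

  scale-as-fibres : ∀ α k g → (if α then scale G k g else ε) ≈
                               twice G (if α ∧ (k == two) then g else ε) ∙
                               (if α ∧ (k == one) then g else ε)
  scale-as-fibres true  one g = ≈-sym (twice-ε-∙ g)
  scale-as-fibres true  two g = ≈-sym (identityʳ _)
  scale-as-fibres false k   g = ≈-sym (twice-ε-∙ ε)

  sumOver-scale : ∀ a (e : ℕ → Coef) (f : ℕ → Carrier) →
                  sumOver G a (λ n → scale G (e n) (f n)) ≈
                  twice G (sumOver G (fibre a e two) f) ∙ sumOver G (fibre a e one) f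
  sumOver-scale a e f =
    ≈-trans (sumBelow-cong (bound a) (λ n → scale-as-fibres (mem a n) (e n) (f n)))
            (≈-sym (sumBelow-twice-∙ (bound a) _ _))

  sumOver-∙-∪ : ∀ a b (f : ℕ → Carrier) → Disjoint a b →
                sumOver G a f ∙ sumOver G (a ∪ b) f ≈ twice G (sumOver G a f) ∙ sumOver G b f
  sumOver-∙-∪ a b f a#b =
    ≈-trans (sumOver-∙ a (a ∪ b) f)
            (∙-cong (∙-cong on-a on-a) (sumOver-cong (a △ (a ∪ b)) b f (△-∪-disjoint a b a#b)))
    where
    on-a : sumOver G (a ∩ (a ∪ b)) f ≈ sumOver G a f
    on-a = sumOver-cong (a ∩ (a ∪ b)) a f (∩-absorbs-∪ a b)

  sumOver-∪-twoIf : ∀ a b (f : ℕ → Carrier) → Disjoint a b →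
                    sumOver G (a ∪ b) (λ n → scale G (twoIf (mem a n)) (f n)) ≈
                    twice G (sumOver G a f) ∙ sumOver G b f
  sumOver-∪-twoIf a b f a#b =
    ≈-trans (sumOver-scale (a ∪ b) (twoIf ∘ mem a) f)
            (∙-cong (∙-cong on-a on-a) on-b)
    where
    on-a : sumOver G (fibre (a ∪ b) (twoIf ∘ mem a) two) f ≈ sumOver G a f
    on-a = sumOver-cong (fibre (a ∪ b) (twoIf ∘ mem a) two) a f (fibre-two-∪ a b)
    on-b : sumOver G (fibre (a ∪ b) (twoIf ∘ mem a) one) f ≈ sumOver G b f
    on-b = sumOver-cong (fibre (a ∪ b) (twoIf ∘ mem a) one) b f (fibre-one-∪ a b a#b)

module Equivalences {c ℓ : Level} (G : AbelianGroup c ℓ) (x : ℕ → AbelianGroup.Carrier G) where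
  open AbelianGroup G using (_≈_) renaming (trans to ≈-trans; sym to ≈-sym)
  open Sums G
  open ≡.≡-Reasoning

  TwoUnique⇒CondII : TwoUnique G x → CondII G x
  TwoUnique⇒CondII unique a b c d a#b c#d 2a+b≈2c+d = a≐c , b≐d
    where
    sameLabels : (a ∪ b ≐ c ∪ d) × (∀ n → mem (a ∪ b) n ≡ true → twoIf (mem a n) ≡ twoIf (mem c n))
    sameLabels = unique (a ∪ b) (c ∪ d) (twoIf ∘ mem a) (twoIf ∘ mem c)
      (≈-trans (sumOver-∪-twoIf a b x a#b) (≈-trans 2a+b≈2c+d (≈-sym (sumOver-∪-twoIf c d x c#d))))
    fibres≐ : ∀ k → fibre (a ∪ b) (twoIf ∘ mem a) k ≐ fibre (c ∪ d) (twoIf ∘ mem c) k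
    fibres≐ k = fibre-cong (a ∪ b) (c ∪ d) k (proj₁ sameLabels) (proj₂ sameLabels)
    a≐c : a ≐ c
    a≐c n = begin
      mem a n                                   ≡⟨ fibre-two-∪ a b n ⟨
      mem (fibre (a ∪ b) (twoIf ∘ mem a) two) n ≡⟨ fibres≐ two n ⟩
      mem (fibre (c ∪ d) (twoIf ∘ mem c) two) n ≡⟨ fibre-two-∪ c d n ⟩
      mem c n                                   ∎
    b≐d : b ≐ d
    b≐d n = begin
      mem b n                                   ≡⟨ fibre-one-∪ a b a#b n ⟨
      mem (fibre (a ∪ b) (twoIf ∘ mem a) one) n ≡⟨ fibres≐ one n ⟩
      mem (fibre (c ∪ d) (twoIf ∘ mem c) one) n ≡⟨ fibre-one-∪ c d c#d n ⟩
      mem d n                                   ∎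

  CondII⇒TwoUnique : CondII G x → TwoUnique G x
  CondII⇒TwoUnique condII a b e d Σa≈Σb = proj₁ ∘ fibres-agree , proj₂ ∘ fibres-agree
    where
    sameFibres : (fibre a e two ≐ fibre b d two) × (fibre a e one ≐ fibre b d one)
    sameFibres = condII (fibre a e two) (fibre a e one) (fibre b d two) (fibre b d one)
      (λ n → fibres-disjoint (mem a n) (e n)) (λ n → fibres-disjoint (mem b n) (d n))
      (≈-trans (≈-sym (sumOver-scale a e x)) (≈-trans Σa≈Σb (sumOver-scale b d x)))
    fibres-agree : ∀ n → (mem a n ≡ mem b n) × (mem a n ≡ true → e n ≡ d n)
    fibres-agree n =
      fibres-injective (mem a n) (mem b n) (e n) (d n) (proj₁ sameFibres n) (proj₂ sameFibres n)

  CondII⇒CondIII : CondII G x → CondIII G x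
  CondII⇒CondIII condII a b c d a+b≈c+d = proj₂ same , proj₁ same
    where
    same : (a ∩ b ≐ c ∩ d) × (a △ b ≐ c △ d)
    same = condII (a ∩ b) (a △ b) (c ∩ d) (c △ d)
      (λ n → ∧-xor-disjoint (mem a n) (mem b n)) (λ n → ∧-xor-disjoint (mem c n) (mem d n))
      (≈-trans (≈-sym (sumOver-∙ a b x)) (≈-trans a+b≈c+d (sumOver-∙ c d x)))

  CondIII⇒CondII : CondIII G x → CondII G x
  CondIII⇒CondII condIII a b c d a#b c#d 2a+b≈2c+d = a≐c , b≐d
    where
    same : (a △ (a ∪ b) ≐ c △ (c ∪ d)) × (a ∩ (a ∪ b) ≐ c ∩ (c ∪ d))
    same = condIII a (a ∪ b) c (c ∪ d)
      (≈-trans (sumOver-∙-∪ a b x a#b) (≈-trans 2a+b≈2c+d (≈-sym (sumOver-∙-∪ c d x c#d))))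
    a≐c : a ≐ c
    a≐c n = begin
      mem a n             ≡⟨ ∩-absorbs-∪ a b n ⟨
      mem (a ∩ (a ∪ b)) n ≡⟨ proj₂ same n ⟩
      mem (c ∩ (c ∪ d)) n ≡⟨ ∩-absorbs-∪ c d n ⟩
      mem c n             ∎
    b≐d : b ≐ d
    b≐d n = begin
      mem b n             ≡⟨ △-∪-disjoint a b a#b n ⟨
      mem (a △ (a ∪ b)) n ≡⟨ proj₁ same n ⟩
      mem (c △ (c ∪ d)) n ≡⟨ △-∪-disjoint c d c#d n ⟩
      mem d n             ∎

mainTheorem6 : ∀ {c ℓ : Level} (G : AbelianGroup c ℓ) (x : ℕ → AbelianGroup.Carrier G) →
                 ((TwoUnique G x → CondII G x) × (CondII G x → TwoUnique G x)) ×
                 ((TwoUnique G x → CondIII G x) × (CondIII G x → TwoUnique G x))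
mainTheorem6 G x =
  (TwoUnique⇒CondII , CondII⇒TwoUnique) ,
  (CondII⇒CondIII ∘ TwoUnique⇒CondII , CondII⇒TwoUnique ∘ CondIII⇒CondII)
  where open Equivalences G x
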